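{- Let $Y$ be a random variable whose moment generating function $E[e^{tY}]$ exists for $|t|<r$, for some $r>0$. Define the probabilistic Stirling numbers of the second kind ${n\brace k}_{Y}$ by $\frac{1}{k!}(E[e^{tY}]-1)^{k}=\sum_{n=k}^{\infty}{n\brace k}_{Y}\frac{t^{n}}{n!}$ $(k\ge0)$, and define $B_{n}^{(c,Y)}(x)$ by $$e^{x(E[e^{\frac{Y}{2}t}]-E[e^{ -\frac{Y}{2}t}])}= \sum_{n=0}^{\infty}B_{n}^{(c,Y)}(x)\frac{t^{n}}{n!}.$$ Then for every $n\ge 0$, $$B_{n}^{(c,Y)}(x)= \Big(\frac{1}{2}\Big)^{n}\sum_{k=0}^{n}\sum_{j=0}^{k}\sum_{l=0}^{n-k}(-1)^{j+k}\binom{n}{k}{n-k \brace l}_{Y}{k \brace j}_{Y}x^{j+l}.$$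
   Context: All generating-function identities are identities of power series in $t$. -}

module Defs where

open import Level using (Level)
open import Data.Nat using (ℕ; zero; suc; _∸_)
open import Data.Nat.Combinatorics using (_C_)
open import Algebra.Bundles using (CommutativeRing)

-- Formal power series in t over a commutative ring R are coefficient
-- sequences ℕ → Carrier (ordinary, not exponential, coefficients).
-- The random variable Y enters only through its moment sequence
-- m n = E[Y^n], via E[e^{sY t}] = Σ_n m n sⁿ tⁿ / n!.
-- `inv` supplies inverses of the positive integers in R
-- (R is a ℚ-algebra, e.g. ℝ); this is carried as a hypothesis in the theorem.

module RingNat {c ℓ : Level} (R : CommutativeRing c ℓ) where

  open CommutativeRing R

  fromℕ : ℕ → Carrier
  fromℕ zero    = 0#
  fromℕ (suc n) = 1# + fromℕ n

  _^_ : Carrier → ℕ → Carrier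
  a ^ zero  = 1#
  a ^ suc n = a * (a ^ n)

  sumTo : ℕ → (ℕ → Carrier) → Carrier
  sumTo zero    f = f 0
  sumTo (suc n) f = sumTo n f + f (suc n)

module ProbStirling {c ℓ : Level} (R : CommutativeRing c ℓ)
                    (inv : ℕ → CommutativeRing.Carrier R)
                    (m : ℕ → CommutativeRing.Carrier R) where

  open CommutativeRing R
  open RingNat R

  fact : ℕ → Carrier
  fact zero    = 1#
  fact (suc n) = fromℕ (suc n) * fact n

  invFact : ℕ → Carrier
  invFact zero    = 1#
  invFact (suc n) = inv (suc n) * invFact n

  half : Carrier
  half = inv 2

  FPS : Set c
  FPS = ℕ → Carrier

  _·_ : FPS → FPS → FPS
  (f · g) n = sumTo n (λ i → f i * g (n ∸ i))

  one : FPS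
  one zero    = 1#
  one (suc n) = 0#

  pow : FPS → ℕ → FPS
  pow f zero    = one
  pow f (suc k) = f · pow f k

  mgf : Carrier → FPS
  mgf s n = m n * (s ^ n) * invFact n

  mgf-1 : FPS
  mgf-1 n = mgf 1# n - one n

  S : ℕ → ℕ → Carrier
  S n k = fact n * (invFact k * pow mgf-1 k n)

  D : FPS
  D n = mgf half n - mgf (- half) n

  -- e^{x D(t)} = Σ_j x^j D(t)^j / j!  (D has zero constant term, so the
  -- coefficient of tⁿ only involves j ≤ n); B_n^{(c,Y)}(x) = n! [tⁿ] e^{x D(t)}
  B : ℕ → Carrier → Carrier
  B n x = fact n * sumTo n (λ j → (x ^ j) * invFact j * pow D j n)

  RHS : ℕ → Carrier → Carrier
  RHS n x = (half ^ n) *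
    sumTo n (λ k → sumTo k (λ j → sumTo (n ∸ k) (λ l →
      ((- 1#) ^ (j Data.Nat.+ k)) * fromℕ (n C k) * S (n ∸ k) l * S k j
        * (x ^ (j Data.Nat.+ l)))))

-- Write A(t) = E[e^{tY}] − 1. Since the constant terms cancel, the exponent is
-- D(t) = −A(−t/2) + A(t/2), a sum of two series without constant term, so
-- e^{xD} = e^{−x A(−t/2)} · e^{x A(t/2)}. Moreover e^{y A(at)} = Σₙ aⁿ φₙ(y) tⁿ/n!, where
-- φₙ(y) = Σₖ S_Y(n,k) yᵏ is the probabilistic Bell polynomial. The product of these two
-- exponential generating functions has n-th coefficient Σₖ C(n,k) (−1/2)ᵏ φₖ(−x) (1/2)ⁿ⁻ᵏ φₙ₋ₖ(x),
-- which expands to the stated triple sum. The exponential law e^{x(f+g)} = e^{xf} e^{xg} itself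
-- comes from the binomial theorem in the semiring of power series.
module Submission where

open import Defs
open import Level using (Level)
open import Data.Nat as ℕ using (ℕ; zero; suc; _∸_; _≤_; _<_; _≤′_; z≤n; s≤s; ≤′-reflexive; ≤′-step; _!; NonZero)
open import Data.Nat.Properties
  using ( ≤-refl; ≤-trans; ≤-<-trans; m≤n⇒m≤1+n; ≤⇒≤′; ≤′⇒≤; ≮⇒≥; _<?_; +-∸-assoc; ∸-+-assoc; n∸n≡0
        ; m∸[m∸n]≡n; m+[n∸m]≡n; m+n∸m≡n; m∸n≤m; m≤n+m∸n; ∸-monoˡ-<; +-monoˡ-≤; +-monoʳ-<; _!*_!≢0 )
open import Data.Nat.DivMod using (m/n*n≡m)
open import Data.Nat.Combinatorics using (_C_; nCk≡n!/k![n-k]!; k![n∸k]!∣n!)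
open import Data.Fin using (toℕ)
open import Algebra.Bundles using (CommutativeRing; CommutativeSemiring)
open import Algebra.Structures.Biased using (isCommutativeSemiringˡ; isCommutativeMonoidˡ)
import Algebra.Construct.Pointwise as Pointwise
import Algebra.Properties.CommutativeSemiring.Binomial
open import Relation.Binary.PropositionalEquality as ≡ using (_≡_)
open import Relation.Nullary using (yes; no)

module FiniteSums {c ℓ : Level} (R : CommutativeRing c ℓ) where

  open CommutativeRing R
  open RingNat R using (sumTo)
  open import Relation.Binary.Reasoning.Setoid setoid

  sumTo-cong : ∀ n {f g : ℕ → Carrier} → (∀ i → i ≤ n → f i ≈ g i) → sumTo n f ≈ sumTo n g
  sumTo-cong zero    f≈g = f≈g 0 z≤n
  sumTo-cong (suc n) f≈g = +-cong (sumTo-cong n (λ i i≤n → f≈g i (m≤n⇒m≤1+n i≤n))) (f≈g (suc n) ≤-refl)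

  sumTo-zero : ∀ n {f : ℕ → Carrier} → (∀ i → i ≤ n → f i ≈ 0#) → sumTo n f ≈ 0#
  sumTo-zero n {f} f≈0 = trans (sumTo-cong n f≈0) (sumTo-const0 n)
    where
    sumTo-const0 : ∀ n → sumTo n (λ _ → 0#) ≈ 0#
    sumTo-const0 zero    = refl
    sumTo-const0 (suc n) = trans (+-identityʳ _) (sumTo-const0 n)

  sumTo-distrib-+ : ∀ n (f g : ℕ → Carrier) → sumTo n (λ i → f i + g i) ≈ sumTo n f + sumTo n g
  sumTo-distrib-+ zero    f g = refl
  sumTo-distrib-+ (suc n) f g = begin
    sumTo n (λ i → f i + g i) + (f (suc n) + g (suc n))  ≈⟨ +-congʳ (sumTo-distrib-+ n f g) ⟩
    (sumTo n f + sumTo n g) + (f (suc n) + g (suc n))    ≈⟨ +-assoc _ _ _ ⟩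
    sumTo n f + (sumTo n g + (f (suc n) + g (suc n)))    ≈⟨ +-congˡ (x∙yz≈y∙xz _ _ _) ⟩
    sumTo n f + (f (suc n) + (sumTo n g + g (suc n)))    ≈⟨ +-assoc _ _ _ ⟨
    (sumTo n f + f (suc n)) + (sumTo n g + g (suc n))    ∎
    where open import Algebra.Properties.CommutativeSemigroup +-commutativeSemigroup using (x∙yz≈y∙xz)

  *-distribˡ-sumTo : ∀ n a (f : ℕ → Carrier) → a * sumTo n f ≈ sumTo n (λ i → a * f i)
  *-distribˡ-sumTo zero    a f = refl
  *-distribˡ-sumTo (suc n) a f = trans (distribˡ _ _ _) (+-congʳ (*-distribˡ-sumTo n a f))

  *-distribʳ-sumTo : ∀ n a (f : ℕ → Carrier) → sumTo n f * a ≈ sumTo n (λ i → f i * a)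
  *-distribʳ-sumTo n a f =
    trans (*-comm _ _) (trans (*-distribˡ-sumTo n a f) (sumTo-cong n (λ i _ → *-comm _ _)))

  sumTo-*-sumTo : ∀ m n (f g : ℕ → Carrier) →
    sumTo m f * sumTo n g ≈ sumTo m (λ i → sumTo n (λ j → f i * g j))
  sumTo-*-sumTo m n f g =
    trans (*-distribʳ-sumTo m _ f) (sumTo-cong m (λ i _ → *-distribˡ-sumTo n (f i) g))

  sumTo-comm : ∀ m n (f : ℕ → ℕ → Carrier) →
    sumTo m (λ i → sumTo n (f i)) ≈ sumTo n (λ j → sumTo m (λ i → f i j))
  sumTo-comm zero    n f = refl
  sumTo-comm (suc m) n f = trans (+-congʳ (sumTo-comm m n f)) (sym (sumTo-distrib-+ n _ _))

  sumTo-unroll : ∀ n (f : ℕ → Carrier) → sumTo (suc n) f ≈ f 0 + sumTo n (λ i → f (suc i))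
  sumTo-unroll zero    f = refl
  sumTo-unroll (suc n) f = trans (+-congʳ (sumTo-unroll n f)) (+-assoc _ _ _)

  sumTo-reverse : ∀ n (f : ℕ → Carrier) → sumTo n f ≈ sumTo n (λ i → f (n ∸ i))
  sumTo-reverse zero    f = refl
  sumTo-reverse (suc n) f = begin
    sumTo (suc n) f                           ≈⟨ sumTo-unroll n f ⟩
    f 0 + sumTo n (λ i → f (suc i))           ≈⟨ +-congˡ (sumTo-reverse n (λ i → f (suc i))) ⟩
    f 0 + sumTo n (λ i → f (suc (n ∸ i)))     ≈⟨ +-comm _ _ ⟩
    sumTo n (λ i → f (suc (n ∸ i))) + f 0
      ≈⟨ +-cong (sumTo-cong n (λ i i≤n → reflexive (≡.cong f (≡.sym (+-∸-assoc 1 i≤n)))))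
                (reflexive (≡.cong f (≡.sym (n∸n≡0 n)))) ⟩
    sumTo (suc n) (λ i → f (suc n ∸ i))       ∎

  sumTo-antidiagonal : ∀ n (f : ℕ → ℕ → Carrier) →
    sumTo n (λ k → sumTo k (λ i → f i (k ∸ i))) ≈ sumTo n (λ i → sumTo (n ∸ i) (f i))
  sumTo-antidiagonal zero    f = refl
  sumTo-antidiagonal (suc n) f = begin
    sumTo n (λ k → sumTo k (λ i → f i (k ∸ i))) + sumTo (suc n) (λ i → f i (suc n ∸ i))
      ≈⟨ +-cong (sumTo-antidiagonal n f) (+-congˡ (reflexive (≡.cong (f (suc n)) (n∸n≡0 n)))) ⟩
    sumTo n (λ i → sumTo (n ∸ i) (f i)) + (sumTo n (λ i → f i (suc n ∸ i)) + f (suc n) 0)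
      ≈⟨ +-assoc _ _ _ ⟨
    (sumTo n (λ i → sumTo (n ∸ i) (f i)) + sumTo n (λ i → f i (suc n ∸ i))) + f (suc n) 0
      ≈⟨ +-cong (trans (sym (sumTo-distrib-+ n _ _)) (sumTo-cong n (λ i i≤n → lengthen i i≤n)))
                (reflexive (≡.cong (λ k → sumTo k (f (suc n))) (≡.sym (n∸n≡0 n)))) ⟩
    sumTo (suc n) (λ i → sumTo (suc n ∸ i) (f i))  ∎
    where
    lengthen : ∀ i → i ≤ n → sumTo (n ∸ i) (f i) + f i (suc n ∸ i) ≈ sumTo (suc n ∸ i) (f i)
    lengthen i i≤n rewrite +-∸-assoc 1 i≤n = refl

  sumTo-extend : ∀ {m} n {f : ℕ → Carrier} → m ≤ n → (∀ i → m < i → i ≤ n → f i ≈ 0#) →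
    sumTo m f ≈ sumTo n f
  sumTo-extend n {f} m≤n = go (≤⇒≤′ m≤n)
    where
    go : ∀ {m n} → m ≤′ n → (∀ i → m < i → i ≤ n → f i ≈ 0#) → sumTo m f ≈ sumTo n f
    go (≤′-reflexive ≡.refl) _   = refl
    go {m} (≤′-step {n} m≤′n) f≈0 = begin
      sumTo m f        ≈⟨ go m≤′n (λ i m<i i≤n → f≈0 i m<i (m≤n⇒m≤1+n i≤n)) ⟩
      sumTo n f        ≈⟨ +-identityʳ _ ⟨
      sumTo n f + 0#   ≈⟨ +-congˡ (f≈0 (suc n) (s≤s (≤′⇒≤ m≤′n)) ≤-refl) ⟨
      sumTo (suc n) f  ∎

module Powers {c ℓ : Level} (R : CommutativeRing c ℓ) where

  open CommutativeRing R
  open RingNat R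
  import Algebra.Properties.Semiring.Exp semiring as Exp
  import Algebra.Properties.CommutativeSemiring.Exp commutativeSemiring as CExp
  import Algebra.Properties.Semiring.Mult semiring as Mult

  ^≡^ : ∀ a n → a ^ n ≡ a Exp.^ n
  ^≡^ a zero    = ≡.refl
  ^≡^ a (suc n) = ≡.cong (a *_) (^≡^ a n)

  ^-+ : ∀ a m n → a ^ (m ℕ.+ n) ≈ a ^ m * a ^ n
  ^-+ a m n rewrite ^≡^ a (m ℕ.+ n) | ^≡^ a m | ^≡^ a n = Exp.^-homo-* a m n

  ^-distrib-* : ∀ a b n → (a * b) ^ n ≈ a ^ n * b ^ n
  ^-distrib-* a b n rewrite ^≡^ (a * b) n | ^≡^ a n | ^≡^ b n = CExp.^-distrib-* a b n

  ^-congˡ : ∀ n {a b} → a ≈ b → a ^ n ≈ b ^ n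
  ^-congˡ n {a} {b} a≈b rewrite ^≡^ a n | ^≡^ b n = Exp.^-congˡ n a≈b

  1^n≈1 : ∀ n → 1# ^ n ≈ 1#
  1^n≈1 zero    = refl
  1^n≈1 (suc n) = trans (*-identityˡ _) (1^n≈1 n)

  fromℕ≡×1 : ∀ n → fromℕ n ≡ n Mult.× 1#
  fromℕ≡×1 zero    = ≡.refl
  fromℕ≡×1 (suc n) = ≡.cong (1# +_) (fromℕ≡×1 n)

  fromℕ-* : ∀ m n → fromℕ (m ℕ.* n) ≈ fromℕ m * fromℕ n
  fromℕ-* m n rewrite fromℕ≡×1 (m ℕ.* n) | fromℕ≡×1 m | fromℕ≡×1 n = Mult.×1-homo-* m n

InvertsPositiveIntegers : ∀ {c ℓ} (R : CommutativeRing c ℓ) → (ℕ → CommutativeRing.Carrier R) → Set ℓ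
InvertsPositiveIntegers R inv = ∀ n → fromℕ (suc n) * inv (suc n) ≈ 1#
  where
  open CommutativeRing R
  open RingNat R

module Factorials {c ℓ : Level} (R : CommutativeRing c ℓ) (inv m : ℕ → CommutativeRing.Carrier R)
                  (inv-correct : InvertsPositiveIntegers R inv) where

  open CommutativeRing R
  open RingNat R
  open ProbStirling R inv m
  open Powers R
  open import Algebra.Properties.CommutativeSemigroup *-commutativeSemigroup using (interchange)
  open import Algebra.Solver.CommutativeMonoid *-commutativeMonoid using (solve; _⊜_) renaming (_⊕_ to _⊗_)
  open import Relation.Binary.Reasoning.Setoid setoid

  fact≈fromℕ! : ∀ n → fact n ≈ fromℕ (n !)
  fact≈fromℕ! zero    = sym (+-identityʳ 1#)
  fact≈fromℕ! (suc n) = trans (*-congˡ (fact≈fromℕ! n)) (sym (fromℕ-* (suc n) (n !)))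

  fact*invFact≈1 : ∀ n → fact n * invFact n ≈ 1#
  fact*invFact≈1 zero    = *-identityˡ 1#
  fact*invFact≈1 (suc n) = begin
    (fromℕ (suc n) * fact n) * (inv (suc n) * invFact n)  ≈⟨ interchange _ _ _ _ ⟩
    (fromℕ (suc n) * inv (suc n)) * (fact n * invFact n)  ≈⟨ *-cong (inv-correct n) (fact*invFact≈1 n) ⟩
    1# * 1#                                               ≈⟨ *-identityˡ 1# ⟩
    1#                                                    ∎

  C*fact*fact≈fact : ∀ {n k} → k ≤ n → fromℕ (n C k) * (fact k * fact (n ∸ k)) ≈ fact n
  C*fact*fact≈fact {n} {k} k≤n = begin
    fromℕ (n C k) * (fact k * fact (n ∸ k))
      ≈⟨ *-congˡ (*-cong (fact≈fromℕ! k) (fact≈fromℕ! (n ∸ k))) ⟩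
    fromℕ (n C k) * (fromℕ (k !) * fromℕ ((n ∸ k) !))
      ≈⟨ trans (*-congˡ (sym (fromℕ-* (k !) ((n ∸ k) !)))) (sym (fromℕ-* (n C k) _)) ⟩
    fromℕ ((n C k) ℕ.* (k ! ℕ.* (n ∸ k) !))
      ≡⟨ ≡.cong fromℕ C*k!*[n∸k]!≡n! ⟩
    fromℕ (n !)
      ≈⟨ fact≈fromℕ! n ⟨
    fact n ∎
    where
    instance
      k!*[n∸k]!≢0 : NonZero (k ! ℕ.* (n ∸ k) !)
      k!*[n∸k]!≢0 = k !* (n ∸ k) !≢0
    C*k!*[n∸k]!≡n! : (n C k) ℕ.* (k ! ℕ.* (n ∸ k) !) ≡ n !
    C*k!*[n∸k]!≡n! = ≡.trans (≡.cong (ℕ._* (k ! ℕ.* (n ∸ k) !)) (nCk≡n!/k![n-k]! k≤n)) (m/n*n≡m (k![n∸k]!∣n! k≤n))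

  invFact*C≈invFact*invFact : ∀ {n k} → k ≤ n → invFact n * fromℕ (n C k) ≈ invFact k * invFact (n ∸ k)
  invFact*C≈invFact*invFact {n} {k} k≤n = begin
    invFact n * fromℕ (n C k)
      ≈⟨ *-identityʳ _ ⟨
    invFact n * fromℕ (n C k) * 1#
      ≈⟨ *-congˡ (trans (*-cong (fact*invFact≈1 k) (fact*invFact≈1 (n ∸ k))) (*-identityʳ 1#)) ⟨
    invFact n * fromℕ (n C k) * ((fact k * invFact k) * (fact (n ∸ k) * invFact (n ∸ k)))
      ≈⟨ solve 6 (λ iN b fk ik fnk inkk → (iN ⊗ b) ⊗ ((fk ⊗ ik) ⊗ (fnk ⊗ inkk))
                                       ⊜ (iN ⊗ (b ⊗ (fk ⊗ fnk))) ⊗ (ik ⊗ inkk))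
                 refl _ _ _ _ _ _ ⟩
    (invFact n * (fromℕ (n C k) * (fact k * fact (n ∸ k)))) * (invFact k * invFact (n ∸ k))
      ≈⟨ *-congʳ (trans (*-congˡ (C*fact*fact≈fact k≤n)) (trans (*-comm _ _) (fact*invFact≈1 n))) ⟩
    1# * (invFact k * invFact (n ∸ k))
      ≈⟨ *-identityˡ _ ⟩
    invFact k * invFact (n ∸ k) ∎

-- ProbStirling bundles the series operations with a moment sequence m, on which they do not depend.
module PowerSeries {c ℓ : Level} (R : CommutativeRing c ℓ) (inv m : ℕ → CommutativeRing.Carrier R) where

  open CommutativeRing R
  open RingNat R
  open ProbStirling R inv m
  open FiniteSums R
  open Powers R
  open import Algebra.Properties.CommutativeSemigroup *-commutativeSemigroup using (interchange)
  open import Relation.Binary.Reasoning.Setoid setoid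

  infix 4 _≋_
  _≋_ : FPS → FPS → Set ℓ
  f ≋ g = ∀ n → f n ≈ g n

  infixl 6 _⊕_
  _⊕_ : FPS → FPS → FPS
  (f ⊕ g) n = f n + g n

  ·-cong : ∀ {f f′ g g′} → f ≋ f′ → g ≋ g′ → f · g ≋ f′ · g′
  ·-cong f≋f′ g≋g′ n = sumTo-cong n (λ i _ → *-cong (f≋f′ i) (g≋g′ (n ∸ i)))

  ·-comm : ∀ f g → f · g ≋ g · f
  ·-comm f g n = begin
    sumTo n (λ i → f i * g (n ∸ i))              ≈⟨ sumTo-reverse n _ ⟩
    sumTo n (λ i → f (n ∸ i) * g (n ∸ (n ∸ i)))
      ≈⟨ sumTo-cong n (λ i i≤n → trans (*-comm _ _) (*-congʳ (reflexive (≡.cong g (m∸[m∸n]≡n i≤n))))) ⟩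
    sumTo n (λ i → g i * f (n ∸ i))              ∎

  ·-assoc : ∀ f g h → (f · g) · h ≋ f · (g · h)
  ·-assoc f g h n = begin
    sumTo n (λ k → sumTo k (λ i → f i * g (k ∸ i)) * h (n ∸ k))
      ≈⟨ sumTo-cong n (λ k _ → trans (*-distribʳ-sumTo k _ _) (sumTo-cong k (λ i i≤k → regroup i≤k))) ⟩
    sumTo n (λ k → sumTo k (λ i → F i (k ∸ i)))
      ≈⟨ sumTo-antidiagonal n F ⟩
    sumTo n (λ i → sumTo (n ∸ i) (F i))
      ≈⟨ sumTo-cong n (λ i _ → sym (*-distribˡ-sumTo (n ∸ i) (f i) _)) ⟩
    sumTo n (λ i → f i * (g · h) (n ∸ i))  ∎
    where
    F : ℕ → ℕ → Carrier
    F i p = f i * (g p * h (n ∸ i ∸ p))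
    regroup : ∀ {i k} → i ≤ k → f i * g (k ∸ i) * h (n ∸ k) ≈ F i (k ∸ i)
    regroup {i} {k} i≤k = trans (*-assoc _ _ _)
      (*-congˡ (*-congˡ (reflexive (≡.cong h (≡.trans (≡.cong (n ∸_) (≡.sym (m+[n∸m]≡n i≤k)))
                                                       (≡.sym (∸-+-assoc n i (k ∸ i))))))))

  ·-identityˡ : ∀ f → one · f ≋ f
  ·-identityˡ f zero    = *-identityˡ _
  ·-identityˡ f (suc n) = begin
    sumTo (suc n) (λ i → one i * f (suc n ∸ i))        ≈⟨ sumTo-unroll n _ ⟩
    1# * f (suc n) + sumTo n (λ i → 0# * f (n ∸ i))    ≈⟨ +-cong (*-identityˡ _) (sumTo-zero n (λ i _ → zeroˡ _)) ⟩
    f (suc n) + 0#                                     ≈⟨ +-identityʳ _ ⟩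
    f (suc n)                                          ∎

  ·-distribʳ : ∀ h f g → (f ⊕ g) · h ≋ f · h ⊕ g · h
  ·-distribʳ h f g n = trans (sumTo-cong n (λ i _ → distribʳ _ _ _)) (sumTo-distrib-+ n _ _)

  ·-zeroˡ : ∀ f → (λ _ → 0#) · f ≋ (λ _ → 0#)
  ·-zeroˡ f n = sumTo-zero n (λ i _ → zeroˡ _)

  seriesSemiring : CommutativeSemiring c ℓ
  seriesSemiring = record
    { isCommutativeSemiring = isCommutativeSemiringˡ record
      { +-isCommutativeMonoid = Pointwise.isCommutativeMonoid ℕ +-isCommutativeMonoid
      ; *-isCommutativeMonoid = isCommutativeMonoidˡ record
        { isSemigroup = record
          { isMagma = record { isEquivalence = Pointwise.isEquivalence ℕ isEquivalence ; ∙-cong = ·-cong }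
          ; assoc   = ·-assoc
          }
        ; identityˡ = ·-identityˡ
        ; comm      = ·-comm
        }
      ; distribʳ = ·-distribʳ
      ; zeroˡ    = ·-zeroˡ
      }
    }

  pow-cong : ∀ {f g} → f ≋ g → ∀ l → pow f l ≋ pow g l
  pow-cong f≋g zero    n = refl
  pow-cong f≋g (suc l)   = ·-cong f≋g (pow-cong f≋g l)

  pow-binomial : ∀ f g l n →
    pow (f ⊕ g) l n ≈ sumTo l (λ i → fromℕ (l C i) * (pow f i · pow g (l ∸ i)) n)
  pow-binomial f g l n = begin
    pow (f ⊕ g) l n                    ≈⟨ pow≋^ (f ⊕ g) l n ⟩
    ((f ⊕ g) ^ˢ l) n                   ≈⟨ Binomial.theorem l f g n ⟩
    Binomial.binomialExpansion f g l n ≈⟨ sum-coefficient l (λ i → (l C i) × ((f ^ˢ i) · (g ^ˢ (l ∸ i)))) n ⟩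
    sumTo l (λ i → ((l C i) × ((f ^ˢ i) · (g ^ˢ (l ∸ i)))) n)
      ≈⟨ sumTo-cong l (λ i _ → trans (×-coefficient (l C i) _ n)
           (*-congˡ (·-cong (λ k → sym (pow≋^ f i k)) (λ k → sym (pow≋^ g (l ∸ i) k)) n))) ⟩
    sumTo l (λ i → fromℕ (l C i) * (pow f i · pow g (l ∸ i)) n)  ∎
    where
    module Binomial = Algebra.Properties.CommutativeSemiring.Binomial seriesSemiring
    module Series = CommutativeSemiring seriesSemiring
    open import Algebra.Properties.Semiring.Exp Series.semiring
      using () renaming (_^_ to _^ˢ_)
    open import Algebra.Definitions.RawMonoid Series.+-rawMonoid using (_×_; sum)

    pow≋^ : ∀ f l → pow f l ≋ f ^ˢ l
    pow≋^ f zero    = λ n → refl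
    pow≋^ f (suc l) = ·-cong (λ n → refl) (pow≋^ f l)

    ×-coefficient : ∀ k f n → (k × f) n ≈ fromℕ k * f n
    ×-coefficient zero    f n = sym (zeroˡ _)
    ×-coefficient (suc k) f n =
      trans (+-cong (sym (*-identityˡ _)) (×-coefficient k f n)) (sym (distribʳ _ _ _))

    sum-coefficient : ∀ l (H : ℕ → FPS) n → sum {suc l} (λ i → H (toℕ i)) n ≈ sumTo l (λ i → H i n)
    sum-coefficient zero    H n = +-identityʳ _
    sum-coefficient (suc l) H n =
      trans (+-congˡ (sum-coefficient l (λ i → H (suc i)) n)) (sym (sumTo-unroll l _))

  OrderAtLeast : ℕ → FPS → Set ℓ
  OrderAtLeast k f = ∀ i → i < k → f i ≈ 0#

  ·-order : ∀ {a b f g} → OrderAtLeast a f → OrderAtLeast b g → OrderAtLeast (a ℕ.+ b) (f · g)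
  ·-order {a} {b} {f} {g} f-ord g-ord n n<a+b = sumTo-zero n term≈0
    where
    term≈0 : ∀ i → i ≤ n → f i * g (n ∸ i) ≈ 0#
    term≈0 i i≤n with i <? a
    ... | yes i<a = trans (*-congʳ (f-ord i i<a)) (zeroˡ _)
    ... | no  i≮a = trans (*-congˡ (g-ord (n ∸ i) n∸i<b)) (zeroʳ _)
      where
      n∸i<b : n ∸ i < b
      n∸i<b = ≡.subst (n ∸ i <_) (m+n∸m≡n i b)
                (∸-monoˡ-< (≤-trans n<a+b (+-monoˡ-≤ b (≮⇒≥ i≮a))) i≤n)

  pow-order : ∀ {f} → OrderAtLeast 1 f → ∀ l → OrderAtLeast l (pow f l)
  pow-order f-ord zero    i ()
  pow-order f-ord (suc l)   = ·-order f-ord (pow-order f-ord l)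

  rescale : Carrier → FPS → FPS
  rescale a f i = a ^ i * f i

  infixr 7 _⋆_
  _⋆_ : Carrier → FPS → FPS
  (d ⋆ f) i = d * f i

  rescale-order : ∀ {k} a {f} → OrderAtLeast k f → OrderAtLeast k (rescale a f)
  rescale-order a f-ord i i<k = trans (*-congˡ (f-ord i i<k)) (zeroʳ _)

  ⋆-order : ∀ {k} d {f} → OrderAtLeast k f → OrderAtLeast k (d ⋆ f)
  ⋆-order d f-ord i i<k = trans (*-congˡ (f-ord i i<k)) (zeroʳ _)

  pow-rescale : ∀ a f l → pow (rescale a f) l ≋ rescale a (pow f l)
  pow-rescale a f zero    zero    = sym (*-identityˡ _)
  pow-rescale a f zero    (suc n) = sym (zeroʳ _)
  pow-rescale a f (suc l) n       = begin
    sumTo n (λ i → rescale a f i * pow (rescale a f) l (n ∸ i))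
      ≈⟨ sumTo-cong n (λ i i≤n → trans (*-congˡ (pow-rescale a f l (n ∸ i))) (collect i≤n)) ⟩
    sumTo n (λ i → a ^ n * (f i * pow f l (n ∸ i)))
      ≈⟨ *-distribˡ-sumTo n _ _ ⟨
    a ^ n * pow f (suc l) n  ∎
    where
    collect : ∀ {i} → i ≤ n → (a ^ i * f i) * (a ^ (n ∸ i) * pow f l (n ∸ i)) ≈ a ^ n * (f i * pow f l (n ∸ i))
    collect {i} i≤n = trans (interchange _ _ _ _)
      (*-congʳ (trans (sym (^-+ a i (n ∸ i))) (reflexive (≡.cong (a ^_) (m+[n∸m]≡n i≤n)))))

  pow-⋆ : ∀ d f l → pow (d ⋆ f) l ≋ (d ^ l) ⋆ pow f l
  pow-⋆ d f zero    n = sym (*-identityˡ _)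
  pow-⋆ d f (suc l) n = begin
    sumTo n (λ i → (d * f i) * pow (d ⋆ f) l (n ∸ i))
      ≈⟨ sumTo-cong n (λ i _ → trans (*-congˡ (pow-⋆ d f l (n ∸ i))) (interchange _ _ _ _)) ⟩
    sumTo n (λ i → d ^ suc l * (f i * pow f l (n ∸ i)))
      ≈⟨ *-distribˡ-sumTo n _ _ ⟨
    d ^ suc l * pow f (suc l) n  ∎

module ExponentialSeries {c ℓ : Level} (R : CommutativeRing c ℓ) (inv m : ℕ → CommutativeRing.Carrier R)
                         (inv-correct : InvertsPositiveIntegers R inv) where

  open CommutativeRing R
  open RingNat R
  open ProbStirling R inv m
  open FiniteSums R
  open Powers R
  open PowerSeries R inv m
  open Factorials R inv m inv-correct
  open import Algebra.Properties.CommutativeSemigroup *-commutativeSemigroup using (interchange; x∙yz≈y∙xz)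
  open import Algebra.Solver.CommutativeMonoid *-commutativeMonoid using (solve; _⊜_) renaming (_⊕_ to _⊗_)
  open import Relation.Binary.Reasoning.Setoid setoid

  -- The coefficient of tⁿ in e^{x f}, provided f has no constant term (so that f^j has none below tʲ).
  expSeries : Carrier → FPS → FPS
  expSeries x f n = sumTo n (λ j → x ^ j * invFact j * pow f j n)

  expSeries-cong : ∀ x {f g} → f ≋ g → expSeries x f ≋ expSeries x g
  expSeries-cong x f≋g n = sumTo-cong n (λ j _ → *-congˡ (pow-cong f≋g j n))

  expSeries-extend : ∀ x {f} → OrderAtLeast 1 f → ∀ {n} N → n ≤ N →
    expSeries x f n ≈ sumTo N (λ j → x ^ j * invFact j * pow f j n)
  expSeries-extend x f-ord N n≤N =
    sumTo-extend N n≤N (λ j n<j _ → trans (*-congˡ (pow-order f-ord j _ n<j)) (zeroʳ _))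

  expSeries-rescale : ∀ x a f → expSeries x (rescale a f) ≋ rescale a (expSeries x f)
  expSeries-rescale x a f n = begin
    sumTo n (λ j → x ^ j * invFact j * pow (rescale a f) j n)
      ≈⟨ sumTo-cong n (λ j _ → trans (*-congˡ (pow-rescale a f j n)) (x∙yz≈y∙xz _ _ _)) ⟩
    sumTo n (λ j → a ^ n * (x ^ j * invFact j * pow f j n))
      ≈⟨ *-distribˡ-sumTo n _ _ ⟨
    a ^ n * expSeries x f n  ∎

  expSeries-⋆ : ∀ x d f → expSeries x (d ⋆ f) ≋ expSeries (x * d) f
  expSeries-⋆ x d f n = sumTo-cong n λ j _ → begin
    x ^ j * invFact j * pow (d ⋆ f) j n
      ≈⟨ *-congˡ (pow-⋆ d f j n) ⟩
    x ^ j * invFact j * (d ^ j * pow f j n)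
      ≈⟨ solve 4 (λ xj i dj p → (xj ⊗ i) ⊗ (dj ⊗ p) ⊜ ((xj ⊗ dj) ⊗ i) ⊗ p) refl _ _ _ _ ⟩
    x ^ j * d ^ j * invFact j * pow f j n
      ≈⟨ *-congʳ (*-congʳ (^-distrib-* x d j)) ⟨
    (x * d) ^ j * invFact j * pow f j n  ∎

  fact*·≈binomial-sum : ∀ f g n → fact n * (f · g) n ≈
    sumTo n (λ k → fromℕ (n C k) * (fact k * f k) * (fact (n ∸ k) * g (n ∸ k)))
  fact*·≈binomial-sum f g n = trans (*-distribˡ-sumTo n _ _) (sumTo-cong n λ k k≤n → begin
    fact n * (f k * g (n ∸ k))
      ≈⟨ *-congʳ (C*fact*fact≈fact k≤n) ⟨
    fromℕ (n C k) * (fact k * fact (n ∸ k)) * (f k * g (n ∸ k))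
      ≈⟨ solve 5 (λ b u v p q → (b ⊗ (u ⊗ v)) ⊗ (p ⊗ q) ⊜ (b ⊗ (u ⊗ p)) ⊗ (v ⊗ q)) refl _ _ _ _ _ ⟩
    fromℕ (n C k) * (fact k * f k) * (fact (n ∸ k) * g (n ∸ k))  ∎)

  module _ (x : Carrier) {f g : FPS} (f-ord : OrderAtLeast 1 f) (g-ord : OrderAtLeast 1 g) (n : ℕ) where

    private
      coeff : ℕ → Carrier
      coeff j = x ^ j * invFact j

      F : ℕ → ℕ → Carrier
      F l p = coeff l * coeff p * (pow f l · pow g p) n

      expand-binomial : ∀ J → coeff J * pow (f ⊕ g) J n ≈ sumTo J (λ l → F l (J ∸ l))
      expand-binomial J = begin
        coeff J * pow (f ⊕ g) J n
          ≈⟨ *-congˡ (pow-binomial f g J n) ⟩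
        coeff J * sumTo J (λ l → fromℕ (J C l) * (pow f l · pow g (J ∸ l)) n)
          ≈⟨ *-distribˡ-sumTo J _ _ ⟩
        sumTo J (λ l → coeff J * (fromℕ (J C l) * (pow f l · pow g (J ∸ l)) n))
          ≈⟨ sumTo-cong J (λ l l≤J → split l≤J) ⟩
        sumTo J (λ l → F l (J ∸ l))  ∎
        where
        split : ∀ {l} → l ≤ J → coeff J * (fromℕ (J C l) * (pow f l · pow g (J ∸ l)) n) ≈ F l (J ∸ l)
        split {l} l≤J = begin
          x ^ J * invFact J * (fromℕ (J C l) * T)
            ≈⟨ solve 4 (λ p q r s → (p ⊗ q) ⊗ (r ⊗ s) ⊜ (p ⊗ (q ⊗ r)) ⊗ s) refl _ _ _ _ ⟩
          x ^ J * (invFact J * fromℕ (J C l)) * T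
            ≈⟨ *-congʳ (*-cong x^J≈x^l*x^[J∸l] (invFact*C≈invFact*invFact l≤J)) ⟩
          x ^ l * x ^ (J ∸ l) * (invFact l * invFact (J ∸ l)) * T
            ≈⟨ *-congʳ (interchange _ _ _ _) ⟩
          F l (J ∸ l)  ∎
          where
          T : Carrier
          T = (pow f l · pow g (J ∸ l)) n
          x^J≈x^l*x^[J∸l] : x ^ J ≈ x ^ l * x ^ (J ∸ l)
          x^J≈x^l*x^[J∸l] = trans (reflexive (≡.cong (x ^_) (≡.sym (m+[n∸m]≡n l≤J)))) (^-+ x l (J ∸ l))

      F-vanishes : ∀ l p → n ∸ l < p → F l p ≈ 0#
      F-vanishes l p n∸l<p = trans (*-congˡ (·-order (pow-order f-ord l) (pow-order g-ord p) n
        (≤-<-trans (m≤n+m∸n n l) (+-monoʳ-< l n∸l<p)))) (zeroʳ _)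

      product-expansion : (expSeries x f · expSeries x g) n ≈ sumTo n (λ l → sumTo n (F l))
      product-expansion = begin
        sumTo n (λ i → expSeries x f i * expSeries x g (n ∸ i))
          ≈⟨ sumTo-cong n (λ i i≤n → *-cong (expSeries-extend x f-ord n i≤n)
                                             (expSeries-extend x g-ord n (m∸n≤m n i))) ⟩
        sumTo n (λ i → sumTo n (λ l → coeff l * pow f l i) * sumTo n (λ p → coeff p * pow g p (n ∸ i)))
          ≈⟨ sumTo-cong n (λ i _ → sumTo-*-sumTo n n _ _) ⟩
        sumTo n (λ i → sumTo n (λ l → sumTo n (λ p → coeff l * pow f l i * (coeff p * pow g p (n ∸ i)))))
          ≈⟨ sumTo-comm n n _ ⟩
        sumTo n (λ l → sumTo n (λ i → sumTo n (λ p → coeff l * pow f l i * (coeff p * pow g p (n ∸ i)))))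
          ≈⟨ sumTo-cong n (λ l _ → sumTo-comm n n _) ⟩
        sumTo n (λ l → sumTo n (λ p → sumTo n (λ i → coeff l * pow f l i * (coeff p * pow g p (n ∸ i)))))
          ≈⟨ sumTo-cong n (λ l _ → sumTo-cong n (λ p _ →
               trans (sumTo-cong n (λ i _ → interchange _ _ _ _)) (sym (*-distribˡ-sumTo n _ _)))) ⟩
        sumTo n (λ l → sumTo n (F l))  ∎

    expSeries-+ : expSeries x (f ⊕ g) n ≈ (expSeries x f · expSeries x g) n
    expSeries-+ = begin
      sumTo n (λ J → coeff J * pow (f ⊕ g) J n)       ≈⟨ sumTo-cong n (λ J _ → expand-binomial J) ⟩
      sumTo n (λ J → sumTo J (λ l → F l (J ∸ l)))     ≈⟨ sumTo-antidiagonal n F ⟩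
      sumTo n (λ l → sumTo (n ∸ l) (F l))
        ≈⟨ sumTo-cong n (λ l _ → sumTo-extend n (m∸n≤m n l) (λ p n∸l<p _ → F-vanishes l p n∸l<p)) ⟩
      sumTo n (λ l → sumTo n (F l))                   ≈⟨ product-expansion ⟨
      (expSeries x f · expSeries x g) n               ∎

module ProbabilisticBell {c ℓ : Level} (R : CommutativeRing c ℓ) (inv m : ℕ → CommutativeRing.Carrier R)
                         (inv-correct : InvertsPositiveIntegers R inv) where

  open CommutativeRing R
  open RingNat R
  open ProbStirling R inv m
  open FiniteSums R
  open Powers R
  open PowerSeries R inv m
  open ExponentialSeries R inv m inv-correct
  open import Algebra.Properties.Ring ring using (-1*x≈-x; -0#≈0#)
  open import Algebra.Solver.CommutativeMonoid *-commutativeMonoid using (solve; _⊜_) renaming (_⊕_ to _⊗_)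
  open import Relation.Binary.Reasoning.Setoid setoid

  bell : ℕ → Carrier → Carrier
  bell n y = sumTo n (λ j → S n j * y ^ j)

  mgf-1-order : m 0 ≈ 1# → OrderAtLeast 1 mgf-1
  mgf-1-order m0≈1 zero _ = trans (+-congʳ (trans (*-identityʳ _) (trans (*-identityʳ _) m0≈1))) (-‿inverseʳ 1#)
  mgf-1-order m0≈1 (suc i) (s≤s ())

  rescale-mgf-1-suc : ∀ a i → rescale a mgf-1 (suc i) ≈ mgf a (suc i)
  rescale-mgf-1-suc a i = begin
    a ^ suc i * (m (suc i) * 1# ^ suc i * invFact (suc i) - 0#)
      ≈⟨ *-congˡ (trans (+-congˡ -0#≈0#) (+-identityʳ _)) ⟩
    a ^ suc i * (m (suc i) * 1# ^ suc i * invFact (suc i))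
      ≈⟨ *-congˡ (*-congʳ (trans (*-congˡ (1^n≈1 (suc i))) (*-identityʳ _))) ⟩
    a ^ suc i * (m (suc i) * invFact (suc i))
      ≈⟨ solve 3 (λ p q r → p ⊗ (q ⊗ r) ⊜ (q ⊗ p) ⊗ r) refl _ _ _ ⟩
    mgf a (suc i)  ∎

  D≋ : D ≋ (- 1#) ⋆ rescale (- half) mgf-1 ⊕ rescale half mgf-1
  D≋ zero    = trans (-‿inverseʳ _) (sym (trans (+-congʳ (-1*x≈-x _)) (-‿inverseˡ _)))
  D≋ (suc i) = sym (trans (+-cong (trans (-1*x≈-x _) (-‿cong (rescale-mgf-1-suc (- half) i)))
                                  (rescale-mgf-1-suc half i))
                          (+-comm _ _))

  fact*expSeries-rescale : ∀ y a n → fact n * expSeries y (rescale a mgf-1) n ≈ a ^ n * bell n y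
  fact*expSeries-rescale y a n = begin
    fact n * expSeries y (rescale a mgf-1) n
      ≈⟨ *-congˡ (expSeries-rescale y a mgf-1 n) ⟩
    fact n * (a ^ n * expSeries y mgf-1 n)
      ≈⟨ x∙yz≈y∙xz _ _ _ ⟩
    a ^ n * (fact n * expSeries y mgf-1 n)
      ≈⟨ *-congˡ (trans (*-distribˡ-sumTo n _ _) (sumTo-cong n (λ j _ → regroup j))) ⟩
    a ^ n * bell n y  ∎
    where
    open import Algebra.Properties.CommutativeSemigroup *-commutativeSemigroup using (x∙yz≈y∙xz)
    regroup : ∀ j → fact n * (y ^ j * invFact j * pow mgf-1 j n) ≈ S n j * y ^ j
    regroup j = solve 4 (λ f yj i p → f ⊗ ((yj ⊗ i) ⊗ p) ⊜ (f ⊗ (i ⊗ p)) ⊗ yj) refl _ _ _ _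

  module _ (x : Carrier) (n : ℕ) where

    private
      h s : Carrier
      h = half
      s = - 1#

      E : ℕ → ℕ → ℕ → Carrier
      E k j l = s ^ (j ℕ.+ k) * fromℕ (n C k) * S (n ∸ k) l * S k j * x ^ (j ℕ.+ l)

      binomial-bell-term : ∀ {k} → k ≤ n →
        fromℕ (n C k) * ((- h) ^ k * bell k (x * s)) * (h ^ (n ∸ k) * bell (n ∸ k) x)
        ≈ h ^ n * sumTo k (λ j → sumTo (n ∸ k) (E k j))
      binomial-bell-term {k} k≤n = begin
        Cnk * ((- h) ^ k * bell k (x * s)) * (h ^ (n ∸ k) * bell (n ∸ k) x)
          ≈⟨ solve 5 (λ b u v p q → (b ⊗ (u ⊗ v)) ⊗ (p ⊗ q) ⊜ ((b ⊗ u) ⊗ p) ⊗ (v ⊗ q)) refl _ _ _ _ _ ⟩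
        c₀ * (bell k (x * s) * bell (n ∸ k) x)
          ≈⟨ *-congˡ (sumTo-*-sumTo k (n ∸ k) _ _) ⟩
        c₀ * sumTo k (λ j → sumTo (n ∸ k) (λ l → S k j * (x * s) ^ j * (S (n ∸ k) l * x ^ l)))
          ≈⟨ trans (*-distribˡ-sumTo k _ _) (sumTo-cong k (λ j _ → *-distribˡ-sumTo (n ∸ k) _ _)) ⟩
        sumTo k (λ j → sumTo (n ∸ k) (λ l → c₀ * (S k j * (x * s) ^ j * (S (n ∸ k) l * x ^ l))))
          ≈⟨ sumTo-cong k (λ j _ → sumTo-cong (n ∸ k) (λ l _ → term j l)) ⟩
        sumTo k (λ j → sumTo (n ∸ k) (λ l → h ^ n * E k j l))
          ≈⟨ trans (*-distribˡ-sumTo k _ _) (sumTo-cong k (λ j _ → *-distribˡ-sumTo (n ∸ k) _ _)) ⟨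
        h ^ n * sumTo k (λ j → sumTo (n ∸ k) (E k j))  ∎
        where
        Cnk c₀ : Carrier
        Cnk = fromℕ (n C k)
        c₀ = Cnk * (- h) ^ k * h ^ (n ∸ k)
        h^n≈h^k*h^[n∸k] : h ^ n ≈ h ^ k * h ^ (n ∸ k)
        h^n≈h^k*h^[n∸k] = trans (reflexive (≡.cong (h ^_) (≡.sym (m+[n∸m]≡n k≤n)))) (^-+ h k (n ∸ k))
        term : ∀ j l → c₀ * (S k j * (x * s) ^ j * (S (n ∸ k) l * x ^ l)) ≈ h ^ n * E k j l
        term j l = begin
          c₀ * (S k j * (x * s) ^ j * (S (n ∸ k) l * x ^ l))
            ≈⟨ *-cong (*-congʳ (*-congˡ (trans (^-congˡ k (sym (-1*x≈-x h))) (^-distrib-* s h k))))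
                      (*-congʳ (*-congˡ (^-distrib-* x s j))) ⟩
          Cnk * (s ^ k * h ^ k) * h ^ (n ∸ k) * (S k j * (x ^ j * s ^ j) * (S (n ∸ k) l * x ^ l))
            ≈⟨ solve 9 (λ hk hnk sj sk b S′ Skj xj xl →
                 ((b ⊗ (sk ⊗ hk)) ⊗ hnk) ⊗ ((Skj ⊗ (xj ⊗ sj)) ⊗ (S′ ⊗ xl))
                 ⊜ (hk ⊗ hnk) ⊗ (((((sj ⊗ sk) ⊗ b) ⊗ S′) ⊗ Skj) ⊗ (xj ⊗ xl)))
                 refl (h ^ k) (h ^ (n ∸ k)) (s ^ j) (s ^ k) Cnk (S (n ∸ k) l) (S k j) (x ^ j) (x ^ l) ⟩
          h ^ k * h ^ (n ∸ k) * (s ^ j * s ^ k * Cnk * S (n ∸ k) l * S k j * (x ^ j * x ^ l))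
            ≈⟨ *-cong h^n≈h^k*h^[n∸k] (*-cong (*-congʳ (*-congʳ (*-congʳ (^-+ s j k)))) (^-+ x j l)) ⟨
          h ^ n * E k j l  ∎

    binomial-bell≈RHS : sumTo n (λ k → fromℕ (n C k) * ((- h) ^ k * bell k (x * s)) * (h ^ (n ∸ k) * bell (n ∸ k) x))
                        ≈ RHS n x
    binomial-bell≈RHS = trans (sumTo-cong n (λ k k≤n → binomial-bell-term k≤n)) (sym (*-distribˡ-sumTo n _ _))

theorem2p4 : ∀ {c ℓ} (R : CommutativeRing c ℓ) →
    let open CommutativeRing R in
    (inv : ℕ → Carrier) →
    (∀ n → RingNat.fromℕ R (suc n) * inv (suc n) ≈ 1#) →
    (m : ℕ → Carrier) → m 0 ≈ 1# →
    ∀ (x : Carrier) (n : ℕ) →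
    ProbStirling.B R inv m n x ≈ ProbStirling.RHS R inv m n x
theorem2p4 R inv inv-correct m m0≈1 x n = begin
  B n x
    ≡⟨⟩
  fact n * expSeries x D n
    ≈⟨ *-congˡ (expSeries-cong x D≋ n) ⟩
  fact n * expSeries x (w ⊕ u) n
    ≈⟨ *-congˡ (expSeries-+ x (⋆-order (- 1#) (rescale-order (- half) (mgf-1-order m0≈1)))
                              (rescale-order half (mgf-1-order m0≈1)) n) ⟩
  fact n * (expSeries x w · expSeries x u) n
    ≈⟨ fact*·≈binomial-sum (expSeries x w) (expSeries x u) n ⟩
  sumTo n (λ k → fromℕ (n C k) * (fact k * expSeries x w k) * (fact (n ∸ k) * expSeries x u (n ∸ k)))
    ≈⟨ sumTo-cong n (λ k _ → *-cong (*-congˡ (trans (*-congˡ (expSeries-⋆ x (- 1#) _ k))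
                                                     (fact*expSeries-rescale _ (- half) k)))
                                    (fact*expSeries-rescale x half (n ∸ k))) ⟩
  sumTo n (λ k → fromℕ (n C k) * ((- half) ^ k * bell k (x * - 1#)) * (half ^ (n ∸ k) * bell (n ∸ k) x))
    ≈⟨ binomial-bell≈RHS x n ⟩
  RHS n x  ∎
  where
  open CommutativeRing R
  open RingNat R
  open ProbStirling R inv m
  open FiniteSums R
  open PowerSeries R inv m
  open ExponentialSeries R inv m inv-correct
  open ProbabilisticBell R inv m inv-correct
  open import Relation.Binary.Reasoning.Setoid setoid
  u w : FPS
  u = rescale half mgf-1
  w = (- 1#) ⋆ rescale (- half) mgf-1
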